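{- Let $k\ge 1$ and let $n \in I_k$. Then the number of $0$ digits in the reduced NAF of $n$ is $\deg(B_{2^k-n})$, and the Hamming weight of the reduced NAF of $n$ is $k-\deg(B_{2^k-n})$.
   Context: The Stern polynomials $B_n(t)\in\mathbb{Z}[t]$ are defined by $B_0=0$, $B_1=1$, $B_{2n}=tB_n$, $B_{2n+1}=B_n+B_{n+1}$. A BSD representation of an integer $n$ is a digit string $(b_{m-1}\cdots b_0)$ with $b_j\in\{1,0,-1\}$ and $n=\sum b_j2^j$; its Hamming weight is the number of nonzero digits. A non-adjacent form (NAF) is a BSD representation in which no two adjacent digits are both nonzero; it is reduced if its leading digit is nonzero. Every positive integer has exactly one reduced NAF; its length is the NAF-bitlength of $n$. $I_k$ denotes the set of positive integers of NAF-bitlength $k$. -}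

module Defs where

open import Data.Nat using (ℕ; zero; suc; _+_; _*_; _∸_; _<_; _≡ᵇ_; _/_; _%_)
open import Data.Integer as ℤ using (ℤ; +_; -[1+_])
open import Data.List using (List; []; _∷_; length)
open import Data.Bool using (Bool; true; false; if_then_else_)
open import Data.Empty using (⊥)
open import Data.Unit using (⊤)
open import Data.Product using (_×_)
open import Relation.Binary.PropositionalEquality using (_≡_; _≢_)

-- Polynomials in ℤ[t], represented by their coefficient functions
-- (coefficient of t^j).  Only finitely supported ones arise below.

Poly : Set
Poly = ℕ → ℤ

0ₚ : Poly
0ₚ _ = + 0

1ₚ : Poly
1ₚ zero    = + 1
1ₚ (suc _) = + 0

_+ₚ_ : Poly → Poly → Poly
(p +ₚ q) j = p j ℤ.+ q j

t*_ : Poly → Poly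
(t* p) zero    = + 0
(t* p) (suc j) = p j

IsDegree : Poly → ℕ → Set
IsDegree p d = (p d ≢ + 0) × (∀ j → d < j → p j ≡ + 0)

-- Stern polynomials: B 0 = 0, B 1 = 1, B (2m) = t B m,
-- B (2m+1) = B m + B (m+1).  Defined with a fuel argument; fuel n+1
-- is always sufficient for argument n.

B-fuel : ℕ → ℕ → Poly
B-fuel zero    _ = 0ₚ
B-fuel (suc f) zero = 0ₚ
B-fuel (suc f) (suc zero) = 1ₚ
B-fuel (suc f) n@(suc (suc _)) =
  if n % 2 ≡ᵇ 0
  then t* (B-fuel f (n / 2))
  else (B-fuel f (n / 2) +ₚ B-fuel f (suc (n / 2)))

B : ℕ → Poly
B n = B-fuel (suc n) n

-- Binary signed digit (BSD) representations, least significant digit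
-- first: the list d₀ ∷ d₁ ∷ … ∷ d_{m-1} ∷ [] denotes Σ dⱼ 2^j.

data Digit : Set where
  d1 dz dm1 : Digit

digitVal : Digit → ℤ
digitVal d1  = + 1
digitVal dz  = + 0
digitVal dm1 = -[1+ 0 ]

value : List Digit → ℤ
value []       = + 0
value (d ∷ ds) = digitVal d ℤ.+ (+ 2) ℤ.* value ds

NonZeroDigit : Digit → Set
NonZeroDigit dz = ⊥
NonZeroDigit _  = ⊤

IsNAF : List Digit → Set
IsNAF []           = ⊤
IsNAF (_ ∷ [])     = ⊤
IsNAF (a ∷ b ∷ ds) = (NonZeroDigit a → NonZeroDigit b → ⊥) × IsNAF (b ∷ ds)

-- leading (most significant, i.e. last) digit is nonzero
LeadingNonZero : List Digit → Set
LeadingNonZero []           = ⊥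
LeadingNonZero (d ∷ [])     = NonZeroDigit d
LeadingNonZero (_ ∷ d ∷ ds) = LeadingNonZero (d ∷ ds)

IsReducedNAF : List Digit → Set
IsReducedNAF ds = IsNAF ds × LeadingNonZero ds

zeroCount : List Digit → ℕ
zeroCount []        = 0
zeroCount (dz ∷ ds) = suc (zeroCount ds)
zeroCount (_  ∷ ds) = zeroCount ds

weight : List Digit → ℕ
weight []        = 0
weight (dz ∷ ds) = weight ds
weight (_  ∷ ds) = suc (weight ds)

-- Since no two nonzero digits are
-- adjacent, it is built from [], [1] and [-1] by prepending a digit 0 or a pair 1, 0 or
-- -1, 0 (least significant first), which turns n into 2n, 4n + 1 or 4n - 1 and hence
-- the complement a = 2^L - n into 2a, 4a - 1 or 4a + 1. Each of these raises deg B by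
-- exactly one: B_{2a} = t B_a, and B_{4a±1} = B_{2a} + B_{2a±1} with
-- deg B_{2a±1} ≤ deg B_a + 1, because the Stern polynomials have nonnegative
-- coefficients (so a sum has the larger degree) and the degrees of B_a and B_{a+1}
-- differ by at most one. So deg B_{2^L - n} counts the zeros.
{-# OPTIONS --safe #-}
module Submission where

open import Defs
open import Data.Nat using (ℕ; _≥_; _∸_; _^_)
open import Data.Integer using (+_)
open import Data.List using (List; length)
open import Data.Product using (_×_; ∃-syntax)
open import Relation.Binary.PropositionalEquality using (_≡_)

open import Data.Bool using (true; false; if_then_else_)
open import Data.Empty using (⊥-elim)
open import Data.Integer as ℤ using (-[1+_])
import Data.Integer.Properties as ℤ
open import Data.List using ([]; _∷_)
open import Data.Nat using (zero; suc; _+_; _*_; _≤_; _<_; _⊔_; _≡ᵇ_; _/_; _%_; z≤n; s≤s)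
open import Data.Nat.DivMod using (m/n<m; m/n≡1+[m∸n]/n; m*n/n≡m; m*n%n≡0; [m+kn]%n≡m%n; +-distrib-/-∣ʳ)
open import Data.Nat.Divisibility using (divides)
open import Data.Nat.Induction using (<-rec)
open import Data.Nat.Tactic.RingSolver using (solve-∀)
open import Data.Nat.Properties
open import Data.Product using (_,_; ∃₂)
open import Data.Sum using (inj₁; inj₂)
open import Data.Unit using (tt)
open import Relation.Binary.Definitions using (tri<; tri≈; tri>)
open import Relation.Binary.PropositionalEquality
  using (_≢_; _≗_; refl; sym; trans; cong; cong₂; subst; ≢-sym; module ≡-Reasoning)

Nonnegative : Poly → Set
Nonnegative p = ∀ j → + 0 ℤ.≤ p j

t*-cong : ∀ {p q} → p ≗ q → t* p ≗ t* q
t*-cong p≗q zero    = refl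
t*-cong p≗q (suc j) = p≗q j

t*-nonnegative : ∀ {p} → Nonnegative p → Nonnegative (t* p)
t*-nonnegative p≥0 zero    = ℤ.≤-refl
t*-nonnegative p≥0 (suc j) = p≥0 j

+ₚ-nonnegative : ∀ {p q} → Nonnegative p → Nonnegative q → Nonnegative (p +ₚ q)
+ₚ-nonnegative p≥0 q≥0 j = ℤ.+-mono-≤ (p≥0 j) (q≥0 j)

IsDegree-resp : ∀ {p q d} → p ≗ q → IsDegree p d → IsDegree q d
IsDegree-resp p≗q (lead , vanish) =
  (λ qd≡0 → lead (trans (p≗q _) qd≡0)) , (λ j d<j → trans (sym (p≗q j)) (vanish j d<j))

IsDegree-unique : ∀ {p a b} → IsDegree p a → IsDegree p b → a ≡ b
IsDegree-unique {a = a} {b} (leadᵃ , vanishᵃ) (leadᵇ , vanishᵇ) with <-cmp a b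
... | tri< a<b _ _ = ⊥-elim (leadᵇ (vanishᵃ b a<b))
... | tri≈ _ a≡b _ = a≡b
... | tri> _ _ b<a = ⊥-elim (leadᵃ (vanishᵇ a b<a))

IsDegree-t* : ∀ {p d} → IsDegree p d → IsDegree (t* p) (suc d)
IsDegree-t* (lead , vanish) = lead , λ { zero () ; (suc j) (s≤s d<j) → vanish j d<j }

IsDegree-+ₚ-≤ : ∀ {p q a b} → Nonnegative p → Nonnegative q →
  IsDegree p a → IsDegree q b → a ≤ b → IsDegree (p +ₚ q) b
IsDegree-+ₚ-≤ {p} {q} {a} {b} p≥0 q≥0 (_ , vanishᵖ) (leadᑫ , vanishᑫ) a≤b = lead , vanish
  where
  lead : p b ℤ.+ q b ≢ + 0
  lead = ≢-sym (ℤ.<⇒≢ (ℤ.+-mono-≤-< (p≥0 b) (ℤ.≤∧≢⇒< (q≥0 b) (≢-sym leadᑫ))))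
  vanish : ∀ j → b < j → p j ℤ.+ q j ≡ + 0
  vanish j b<j = cong₂ ℤ._+_ (vanishᵖ j (≤-<-trans a≤b b<j)) (vanishᑫ j b<j)

IsDegree-+ₚ-≥ : ∀ {p q a b} → Nonnegative p → Nonnegative q →
  IsDegree p a → IsDegree q b → b ≤ a → IsDegree (p +ₚ q) a
IsDegree-+ₚ-≥ {p} {q} p≥0 q≥0 deg-p deg-q b≤a =
  IsDegree-resp (λ j → ℤ.+-comm (q j) (p j)) (IsDegree-+ₚ-≤ q≥0 p≥0 deg-q deg-p b≤a)

IsDegree-+ₚ : ∀ {p q a b} → Nonnegative p → Nonnegative q →
  IsDegree p a → IsDegree q b → IsDegree (p +ₚ q) (a ⊔ b)
IsDegree-+ₚ {a = a} {b} p≥0 q≥0 deg-p deg-q with ≤-total a b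
... | inj₁ a≤b = subst (IsDegree _) (sym (m≤n⇒m⊔n≡n a≤b)) (IsDegree-+ₚ-≤ p≥0 q≥0 deg-p deg-q a≤b)
... | inj₂ b≤a = subst (IsDegree _) (sym (m≥n⇒m⊔n≡m b≤a)) (IsDegree-+ₚ-≥ p≥0 q≥0 deg-p deg-q b≤a)

[2+n]/2≡1+n/2 : ∀ n → (2 + n) / 2 ≡ suc (n / 2)
[2+n]/2≡1+n/2 n = m/n≡1+[m∸n]/n {2 + n} {2} (s≤s (s≤s z≤n))

half-< : ∀ {n h} → 2 + n ≤ h → (2 + n) / 2 < h
half-< {n} = <-≤-trans (m/n<m (2 + n) 2 (s≤s (s≤s z≤n)))

suc-half-< : ∀ {n h} → 3 + n ≤ h → suc ((3 + n) / 2) < h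
suc-half-< {n} rewrite [2+n]/2≡1+n/2 (suc n) =
  <-≤-trans (s≤s (s≤s (m/n<m (suc n) 2 (s≤s (s≤s z≤n)))))

2*m%2≡0 : ∀ m → 2 * m % 2 ≡ 0
2*m%2≡0 m = trans (cong (_% 2) (*-comm 2 m)) (m*n%n≡0 m 2)

[1+2*m]%2≡1 : ∀ m → (1 + 2 * m) % 2 ≡ 1
[1+2*m]%2≡1 m = trans (cong (λ n → suc n % 2) (*-comm 2 m)) ([m+kn]%n≡m%n 1 m 2)

2*m/2≡m : ∀ m → 2 * m / 2 ≡ m
2*m/2≡m m = trans (cong (_/ 2) (*-comm 2 m)) (m*n/n≡m m 2)

[1+2*m]/2≡m : ∀ m → (1 + 2 * m) / 2 ≡ m
[1+2*m]/2≡m m = trans (+-distrib-/-∣ʳ 1 (divides m (*-comm 2 m))) (2*m/2≡m m)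

B-fuel-irrelevant : ∀ {f g} n → n < f → n < g → B-fuel f n ≗ B-fuel g n
B-fuel-irrelevant {suc f} {suc g} 0 _ _ _ = refl
B-fuel-irrelevant {suc f} {suc g} 1 _ _ _ = refl
B-fuel-irrelevant {suc f} {suc g} 2 (s≤s 2≤f) (s≤s 2≤g) =
  t*-cong (B-fuel-irrelevant 1 2≤f 2≤g)
B-fuel-irrelevant {suc f} {suc g} (suc (suc (suc m))) (s≤s n≤f) (s≤s n≤g) j
  with (3 + m) % 2 ≡ᵇ 0
... | true  = t*-cong (B-fuel-irrelevant _ (half-< n≤f) (half-< n≤g)) j
... | false = cong₂ ℤ._+_ (B-fuel-irrelevant _ (half-< n≤f) (half-< n≤g) j)
                          (B-fuel-irrelevant _ (suc-half-< n≤f) (suc-half-< n≤g) j)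

B-fuel-sufficient : ∀ {f} n → n < f → B-fuel f n ≗ B n
B-fuel-sufficient n n<f = B-fuel-irrelevant n n<f ≤-refl

B-fuel-even : ∀ f n → n % 2 ≡ 0 → B-fuel (suc f) (2 + n) ≡ t* B-fuel f ((2 + n) / 2)
B-fuel-even f n n%2≡0 = cong (λ r → if r ≡ᵇ 0 then t* B-fuel f ((2 + n) / 2)
  else (B-fuel f ((2 + n) / 2) +ₚ B-fuel f (suc ((2 + n) / 2)))) n%2≡0

B-fuel-odd : ∀ f n → n % 2 ≡ 1 →
  B-fuel (suc f) (2 + n) ≡ B-fuel f ((2 + n) / 2) +ₚ B-fuel f (suc ((2 + n) / 2))
B-fuel-odd f n n%2≡1 = cong (λ r → if r ≡ᵇ 0 then t* B-fuel f ((2 + n) / 2)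
  else (B-fuel f ((2 + n) / 2) +ₚ B-fuel f (suc ((2 + n) / 2)))) n%2≡1

B-double : ∀ m → B (2 * m) ≗ t* B m
B-double zero    zero    = refl
B-double zero    (suc j) = refl
B-double (suc m) j = begin
  B (2 * suc m) j                              ≡⟨ cong (λ n → B n j) (*-suc 2 m) ⟩
  B-fuel (3 + 2 * m) (2 + 2 * m) j             ≡⟨ cong (λ p → p j) (B-fuel-even (2 + 2 * m) (2 * m) (2*m%2≡0 m)) ⟩
  (t* B-fuel (2 + 2 * m) ((2 + 2 * m) / 2)) j  ≡⟨ cong (λ n → (t* B-fuel (2 + 2 * m) n) j) half ⟩
  (t* B-fuel (2 + 2 * m) (1 + m)) j            ≡⟨ t*-cong (B-fuel-sufficient (1 + m) (s≤s (s≤s (m≤m+n m _)))) j ⟩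
  (t* B (1 + m)) j                             ∎
  where
  open ≡-Reasoning
  half : (2 + 2 * m) / 2 ≡ 1 + m
  half = trans ([2+n]/2≡1+n/2 (2 * m)) (cong suc (2*m/2≡m m))

B-odd : ∀ m → B (1 + 2 * m) ≗ B m +ₚ B (1 + m)
B-odd zero    zero    = refl
B-odd zero    (suc j) = refl
B-odd (suc m) j = begin
  B (1 + 2 * suc m) j                ≡⟨ cong (λ n → B (suc n) j) (*-suc 2 m) ⟩
  B-fuel (4 + 2 * m) (3 + 2 * m) j   ≡⟨ cong (λ p → p j) (B-fuel-odd (3 + 2 * m) (1 + 2 * m) ([1+2*m]%2≡1 m)) ⟩
  B-fuel (3 + 2 * m) ((3 + 2 * m) / 2) j ℤ.+ B-fuel (3 + 2 * m) (suc ((3 + 2 * m) / 2)) j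
    ≡⟨ cong (λ n → B-fuel (3 + 2 * m) n j ℤ.+ B-fuel (3 + 2 * m) (suc n) j) half ⟩
  B-fuel (3 + 2 * m) (1 + m) j ℤ.+ B-fuel (3 + 2 * m) (2 + m) j
    ≡⟨ cong₂ ℤ._+_ (B-fuel-sufficient (1 + m) (s≤s (s≤s (m≤n⇒m≤1+n (m≤m+n m _)))) j)
                   (B-fuel-sufficient (2 + m) (s≤s (s≤s (s≤s (m≤m+n m _)))) j) ⟩
  B (1 + m) j ℤ.+ B (2 + m) j        ∎
  where
  open ≡-Reasoning
  half : (3 + 2 * m) / 2 ≡ 1 + m
  half = trans ([2+n]/2≡1+n/2 (1 + 2 * m)) (cong suc ([1+2*m]/2≡m m))

B-fuel-nonnegative : ∀ f n → Nonnegative (B-fuel f n)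
B-fuel-nonnegative zero    _             _       = ℤ.≤-refl
B-fuel-nonnegative (suc f) 0             _       = ℤ.≤-refl
B-fuel-nonnegative (suc f) 1             zero    = ℤ.+≤+ z≤n
B-fuel-nonnegative (suc f) 1             (suc j) = ℤ.≤-refl
B-fuel-nonnegative (suc f) (suc (suc n)) with (2 + n) % 2 ≡ᵇ 0
... | true  = t*-nonnegative (B-fuel-nonnegative f _)
... | false = +ₚ-nonnegative (B-fuel-nonnegative f _) (B-fuel-nonnegative f _)

B-nonnegative : ∀ n → Nonnegative (B n)
B-nonnegative n = B-fuel-nonnegative (suc n) n

B-degree-1 : IsDegree (B 1) 0
B-degree-1 = (λ ()) , λ { zero () ; (suc j) _ → refl }

B-degree-double : ∀ m {d} → IsDegree (B m) d → IsDegree (B (2 * m)) (suc d)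
B-degree-double m deg = IsDegree-resp (λ j → sym (B-double m j)) (IsDegree-t* deg)

B-degree-odd : ∀ m {d e} → IsDegree (B m) d → IsDegree (B (1 + m)) e →
  IsDegree (B (1 + 2 * m)) (d ⊔ e)
B-degree-odd m deg-m deg-1+m = IsDegree-resp (λ j → sym (B-odd m j))
  (IsDegree-+ₚ (B-nonnegative m) (B-nonnegative (1 + m)) deg-m deg-1+m)

Adjacent : ℕ → Set
Adjacent a = ∃₂ λ d e → IsDegree (B a) d × IsDegree (B (suc a)) e × e ≤ suc d × d ≤ suc e

Adjacent-double : ∀ m → Adjacent (suc m) → Adjacent (2 * suc m)
Adjacent-double m (d , e , deg-d , deg-e , e≤1+d , _) =
  suc d , d ⊔ e , B-degree-double (suc m) deg-d , B-degree-odd (suc m) deg-d deg-e ,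
  ⊔-lub (m≤n⇒m≤1+n (n≤1+n d)) (m≤n⇒m≤1+n e≤1+d) , s≤s (m≤m⊔n d e)

Adjacent-odd : ∀ m → Adjacent (suc m) → Adjacent (1 + 2 * suc m)
Adjacent-odd m (d , e , deg-d , deg-e , _ , d≤1+e) =
  d ⊔ e , suc e , B-degree-odd (suc m) deg-d deg-e ,
  subst (λ n → IsDegree (B n) (suc e)) (*-suc 2 (suc m)) (B-degree-double (2 + m) deg-e) ,
  s≤s (m≤n⊔m d e) , ⊔-lub (m≤n⇒m≤1+n d≤1+e) (m≤n⇒m≤1+n (n≤1+n e))

data EvenOrOdd : ℕ → Set where
  even : ∀ m → EvenOrOdd (2 * m)
  odd  : ∀ m → EvenOrOdd (1 + 2 * m)

evenOrOdd : ∀ n → EvenOrOdd n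
evenOrOdd zero = even 0
evenOrOdd (suc n) with evenOrOdd n
... | even m = odd m
... | odd m  = subst EvenOrOdd (*-suc 2 m) (even (suc m))

B-adjacent : ∀ a → Adjacent (suc a)
B-adjacent = <-rec (λ a → Adjacent (suc a)) step
  where
  step : ∀ a → (∀ {b} → b < a → Adjacent (suc b)) → Adjacent (suc a)
  step a rec with evenOrOdd a
  ... | even zero    = 0 , 1 , B-degree-1 , B-degree-double 1 B-degree-1 , ≤-refl , z≤n
  ... | even (suc m) = Adjacent-odd m (rec (s≤s (m≤m+n m _)))
  ... | odd m        = subst Adjacent (*-suc 2 m) (Adjacent-double m (rec (s≤s (m≤m+n m _))))

B-degree-pred-≤ : ∀ b {z} → IsDegree (B (2 + b)) z → ∃[ d ] (IsDegree (B (1 + b)) d × d ≤ suc z)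
B-degree-pred-≤ b deg with B-adjacent b
... | d , e , deg-d , deg-e , _ , d≤1+e rewrite IsDegree-unique deg-e deg = d , deg-d , d≤1+e

B-degree-suc-≤ : ∀ a {z} → IsDegree (B (1 + a)) z → ∃[ e ] (IsDegree (B (2 + a)) e × e ≤ suc z)
B-degree-suc-≤ a deg with B-adjacent a
... | d , e , deg-d , deg-e , e≤1+d , _ rewrite IsDegree-unique deg-d deg = e , deg-e , e≤1+d

B-degree-2a-1-≤ : ∀ a {z} → IsDegree (B (1 + a)) z → ∃[ c ] (IsDegree (B (1 + 2 * a)) c × c ≤ suc z)
B-degree-2a-1-≤ zero    _ = 0 , B-degree-1 , z≤n
B-degree-2a-1-≤ (suc a) {z} deg with B-degree-pred-≤ a deg
... | d , deg-d , d≤1+z = d ⊔ z , B-degree-odd (1 + a) deg-d deg , ⊔-lub d≤1+z (n≤1+n z)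

B-degree-2a+1-≤ : ∀ a {z} → IsDegree (B (1 + a)) z → ∃[ c ] (IsDegree (B (1 + 2 * (1 + a))) c × c ≤ suc z)
B-degree-2a+1-≤ a {z} deg with B-degree-suc-≤ a deg
... | e , deg-e , e≤1+z = z ⊔ e , B-degree-odd (1 + a) deg deg-e , ⊔-lub (n≤1+n z) e≤1+z

B-degree-4a-1 : ∀ a {z} → IsDegree (B (1 + a)) z → IsDegree (B (1 + 2 * (1 + 2 * a))) (suc z)
B-degree-4a-1 a {z} deg with B-degree-2a-1-≤ a deg
... | c , deg-c , c≤1+z = IsDegree-resp (λ j → sym (B-odd (1 + 2 * a) j))
  (IsDegree-+ₚ-≤ (B-nonnegative (1 + 2 * a)) (B-nonnegative (2 + 2 * a)) deg-c deg-2a c≤1+z)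
  where
  deg-2a : IsDegree (B (2 + 2 * a)) (suc z)
  deg-2a = subst (λ n → IsDegree (B n) (suc z)) (*-suc 2 a) (B-degree-double (1 + a) deg)

B-degree-4a+1 : ∀ a {z} → IsDegree (B (1 + a)) z → IsDegree (B (1 + 2 * (2 * (1 + a)))) (suc z)
B-degree-4a+1 a deg with B-degree-2a+1-≤ a deg
... | c , deg-c , c≤1+z = IsDegree-resp (λ j → sym (B-odd (2 * (1 + a)) j))
  (IsDegree-+ₚ-≥ (B-nonnegative (2 * (1 + a))) (B-nonnegative (1 + 2 * (1 + a)))
    (B-degree-double (1 + a) deg) deg-c c≤1+z)

2*-[1+m] : ∀ m → + 2 ℤ.* -[1+ m ] ≡ -[1+ suc (2 * m) ]
2*-[1+m] m = cong -[1+_] (+-suc m (m + 0))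

value-∷-nonnegative : ∀ d v {n} → digitVal d ℤ.+ + 2 ℤ.* v ≡ + n →
  ∃[ m ] (v ≡ + m × digitVal d ℤ.+ + (2 * m) ≡ + n)
value-∷-nonnegative d (+ m)     eq = m , refl , trans (cong (ℤ._+_ (digitVal d)) (ℤ.pos-* 2 m)) eq
value-∷-nonnegative d -[1+ m ] eq =
  ⊥-elim (negative d (trans (cong (ℤ._+_ (digitVal d)) (sym (2*-[1+m] m))) eq))
  where
  negative : ∀ d {k n} → digitVal d ℤ.+ -[1+ suc k ] ≢ + n
  negative d1  ()
  negative dz  ()
  negative dm1 ()

-1+k≡n⇒k≡1+n : ∀ {k n} → -[1+ 0 ] ℤ.+ + k ≡ + n → k ≡ suc n
-1+k≡n⇒k≡1+n {suc k} eq = cong suc (ℤ.+-injective eq)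

-- The complement a = 2 ^ length ds ∸ n is kept additive, avoiding truncated subtraction.
ComplementDegree : List Digit → Set
ComplementDegree ds = ∀ {n} → value ds ≡ + n →
  ∃[ a ] (2 ^ length ds ≡ n + a × IsDegree (B a) (zeroCount ds))

ComplementDegree-[] : ComplementDegree []
ComplementDegree-[] refl = 1 , refl , B-degree-1

ComplementDegree-[1] : ComplementDegree (d1 ∷ [])
ComplementDegree-[1] refl = 1 , refl , B-degree-1

ComplementDegree-[-1] : ComplementDegree (dm1 ∷ [])
ComplementDegree-[-1] ()

ComplementDegree-0∷ : ∀ {ds} → ComplementDegree ds → ComplementDegree (dz ∷ ds)
ComplementDegree-0∷ {ds} cd eq with value-∷-nonnegative dz (value ds) eq
... | m , eqᵐ , refl with cd eqᵐ
... | a , 2^L≡m+a , deg = 2 * a , 2^1+L≡2m+2a , B-degree-double a deg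
  where
  2^1+L≡2m+2a : 2 * 2 ^ length ds ≡ 2 * m + 2 * a
  2^1+L≡2m+2a = trans (cong (2 *_) 2^L≡m+a) (*-distribˡ-+ 2 m a)

ComplementDegree-10∷ : ∀ {ds} → ComplementDegree ds → ComplementDegree (d1 ∷ dz ∷ ds)
ComplementDegree-10∷ {ds} cd eq with value-∷-nonnegative d1 (value (dz ∷ ds)) eq
... | w , eqʷ , refl with value-∷-nonnegative dz (value ds) eqʷ
... | m , eqᵐ , refl with cd eqᵐ
... | zero  , _ , (lead , _) = ⊥-elim (lead refl)
... | suc b , 2^L≡m+1+b , deg = 1 + 2 * (1 + 2 * b) , 2^2+L≡n+a , B-degree-4a-1 b deg
  where
  identity : ∀ m b → 2 * (2 * (m + (1 + b))) ≡ (1 + 2 * (2 * m)) + (1 + 2 * (1 + 2 * b))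
  identity = solve-∀
  2^2+L≡n+a : 2 * (2 * 2 ^ length ds) ≡ (1 + 2 * (2 * m)) + (1 + 2 * (1 + 2 * b))
  2^2+L≡n+a = trans (cong (λ x → 2 * (2 * x)) 2^L≡m+1+b) (identity m b)

ComplementDegree-¯10∷ : ∀ {ds} → ComplementDegree ds → ComplementDegree (dm1 ∷ dz ∷ ds)
ComplementDegree-¯10∷ {ds} cd {n} eq with value-∷-nonnegative dm1 (value (dz ∷ ds)) eq
... | w , eqʷ , eqⁿ with value-∷-nonnegative dz (value ds) eqʷ
... | m , eqᵐ , refl with cd eqᵐ
... | zero  , _ , (lead , _) = ⊥-elim (lead refl)
... | suc a , 2^L≡m+a , deg = 1 + 2 * (2 * suc a) , 2^2+L≡n+a , B-degree-4a+1 a deg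
  where
  open ≡-Reasoning
  identity : ∀ m a → 2 * (2 * (m + a)) ≡ 2 * (2 * m) + 2 * (2 * a)
  identity = solve-∀
  2^2+L≡n+a : 2 * (2 * 2 ^ length ds) ≡ n + (1 + 2 * (2 * suc a))
  2^2+L≡n+a = begin
    2 * (2 * 2 ^ length ds)          ≡⟨ cong (λ x → 2 * (2 * x)) 2^L≡m+a ⟩
    2 * (2 * (m + suc a))            ≡⟨ identity m (suc a) ⟩
    2 * (2 * m) + 2 * (2 * suc a)    ≡⟨ cong (_+ 2 * (2 * suc a)) (-1+k≡n⇒k≡1+n eqⁿ) ⟩
    suc n + 2 * (2 * suc a)          ≡⟨ +-suc n _ ⟨
    n + (1 + 2 * (2 * suc a))        ∎

IsNAF-tail : ∀ d ds → IsNAF (d ∷ ds) → IsNAF ds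
IsNAF-tail _ []      _         = tt
IsNAF-tail _ (_ ∷ _) (_ , naf) = naf

NAF-complementDegree : ∀ ds → IsNAF ds → ComplementDegree ds
NAF-complementDegree []              _   = ComplementDegree-[]
NAF-complementDegree (d1 ∷ [])       _   = ComplementDegree-[1]
NAF-complementDegree (dm1 ∷ [])      _   = ComplementDegree-[-1]
NAF-complementDegree (dz ∷ ds)       naf =
  ComplementDegree-0∷ {ds} (NAF-complementDegree ds (IsNAF-tail dz ds naf))
NAF-complementDegree (d1 ∷ dz ∷ ds)  (_ , naf) =
  ComplementDegree-10∷ {ds} (NAF-complementDegree ds (IsNAF-tail dz ds naf))
NAF-complementDegree (dm1 ∷ dz ∷ ds) (_ , naf) =
  ComplementDegree-¯10∷ {ds} (NAF-complementDegree ds (IsNAF-tail dz ds naf))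
NAF-complementDegree (d1 ∷ d1 ∷ _)   (nonadjacent , _) = ⊥-elim (nonadjacent tt tt)
NAF-complementDegree (d1 ∷ dm1 ∷ _)  (nonadjacent , _) = ⊥-elim (nonadjacent tt tt)
NAF-complementDegree (dm1 ∷ d1 ∷ _)  (nonadjacent , _) = ⊥-elim (nonadjacent tt tt)
NAF-complementDegree (dm1 ∷ dm1 ∷ _) (nonadjacent , _) = ⊥-elim (nonadjacent tt tt)

weight+zeroCount≡length : ∀ ds → weight ds + zeroCount ds ≡ length ds
weight+zeroCount≡length []         = refl
weight+zeroCount≡length (d1 ∷ ds)  = cong suc (weight+zeroCount≡length ds)
weight+zeroCount≡length (dm1 ∷ ds) = cong suc (weight+zeroCount≡length ds)
weight+zeroCount≡length (dz ∷ ds)  =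
  trans (+-suc (weight ds) (zeroCount ds)) (cong suc (weight+zeroCount≡length ds))

weight≡length∸zeroCount : ∀ ds → weight ds ≡ length ds ∸ zeroCount ds
weight≡length∸zeroCount ds = trans (sym (m+n∸n≡m (weight ds) (zeroCount ds)))
                                   (cong (_∸ zeroCount ds) (weight+zeroCount≡length ds))

mainTheorem6 : (k : ℕ) → k ≥ 1 → (n : ℕ) → n ≥ 1 →
    (ds : List Digit) → IsReducedNAF ds → value ds ≡ + n → length ds ≡ k →
    ∃[ d ] (IsDegree (B (2 ^ k ∸ n)) d × zeroCount ds ≡ d × weight ds ≡ k ∸ d)
mainTheorem6 _ _ n _ ds (naf , _) value≡n refl with NAF-complementDegree ds naf value≡n
... | a , 2^k≡n+a , deg =
  zeroCount ds , subst (λ x → IsDegree (B x) (zeroCount ds)) (sym 2^k∸n≡a) deg ,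
  refl , weight≡length∸zeroCount ds
  where
  2^k∸n≡a : 2 ^ length ds ∸ n ≡ a
  2^k∸n≡a = trans (cong (_∸ n) 2^k≡n+a) (m+n∸m≡n n a)
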